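{- Let $p\in\mathbb N$ and let $o=wsw'$ be an $\mathcal N_{BS-R}$-valid operation with destination set $S=\{s\}$. Let $m:=\min\{j:v_j\in S\}$ and $M:=\max\{j:v_j\in S\}$. Then $v_i\in S$ for all $i\in[m+p,M-p]$.
   Context: Setting: $V_d=\{v_1,\dots,v_{n_d}\}$ destinations, $V_r$ replenishment locations (RLs) containing $w_0,w_t$. An operation is $wsw'=(w,v_{O1},\dots,v_{Ok},w')$ with $w,w'\in V_r$, $k\ge1$, distinct destinations; $\{s\}$ is its destination set. A drone tour is an alternating sequence of recharging legs (pairs of RLs) and operations, from $w_0$ to $w_t$, consecutive pieces connected, visiting each destination exactly once; $\pi_d(V_d)$ is the visiting order of destinations. For $x=(v_1,\dots,v_{n_d})$ and a permutation $\sigma$ of $[n_d]$ ($\sigma(i)$ = new position of $v_i$), $(v_{\sigma^{ -1}(1)},\dots,v_{\sigma^{ -1}(n_d)})\in\mathcal N_{BS}(x,p)$ iff $\sigma(i)<\sigma(j)$ for all $i,j$ with $i+p\le j$. $\mathcal N_{BS-R}(x,p)$ is the set of drone tours $\pi_d$ with $\pi_d(V_d)\in\mathcal N_{BS}(x,p)$. An operation is $\mathcal N_{BS-R}$-valid if it occurs in at least one drone tour of $\mathcal N_{BS-R}(x,p)$. $[a,b]=\{a,\dots,b\}$ (empty if $a>b$). -}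

module Defs where

open import Data.Nat using (ℕ; _+_; _≤_; _<_)
open import Data.Fin using (Fin; toℕ)
open import Data.List using (List; []; _∷_; _++_; concatMap)
open import Data.List.Membership.Propositional using (_∈_)
open import Data.List.Relation.Unary.All using (All)
open import Data.List.Relation.Unary.Linked using (Linked)
open import Data.List.Relation.Unary.Unique.Propositional using (Unique)
open import Data.Product using (_×_; _,_; ∃; ∃-syntax; Σ)
open import Relation.Binary.PropositionalEquality using (_≡_; _≢_)
open import Relation.Nullary using (¬_)
open import Data.Empty using (⊥)
open import Data.Unit using (⊤)

-- Destinations v_1..v_{n_d} are represented by their indices in Fin nd
-- (0-based: v_{i+1} ↔ i); the reference order x is (v_1,...,v_{n_d}).
-- Replenishment locations form an arbitrary type R.

record Operation (nd : ℕ) (R : Set) : Set where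
  constructor op
  field
    start : R
    dests : List (Fin nd)
    end   : R
open Operation public

IsOperation : ∀ {nd R} → Operation nd R → Set
IsOperation o = (¬ (dests o ≡ [])) × Unique (dests o)

_∈S_ : ∀ {nd R} → Fin nd → Operation nd R → Set
v ∈S o = v ∈ dests o

-- A piece of a drone tour: a recharging leg (pair of RLs) or an operation.
data Piece (nd : ℕ) (R : Set) : Set where
  leg  : R → R → Piece nd R
  oper : Operation nd R → Piece nd R

pstart : ∀ {nd R} → Piece nd R → R
pstart (leg w _) = w
pstart (oper o)  = start o

pend : ∀ {nd R} → Piece nd R → R
pend (leg _ w') = w'
pend (oper o)   = end o

DiffKind : ∀ {nd R} → Piece nd R → Piece nd R → Set
DiffKind (leg _ _) (leg _ _) = ⊥
DiffKind (leg _ _) (oper _)  = ⊤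
DiffKind (oper _)  (leg _ _) = ⊤
DiffKind (oper _)  (oper _)  = ⊥

data Path {nd : ℕ} {R : Set} : R → List (Piece nd R) → R → Set where
  done : ∀ {w} → Path w [] w
  step : ∀ {w w'} (pc : Piece nd R) {ps} →
         pstart pc ≡ w → Path (pend pc) ps w' → Path w (pc ∷ ps) w'

PieceOK : ∀ {nd R} → Piece nd R → Set
PieceOK (leg _ _) = ⊤
PieceOK (oper o)  = IsOperation o

visitOrder : ∀ {nd R} → List (Piece nd R) → List (Fin nd)
visitOrder = concatMap f
  where
  f : ∀ {nd R} → Piece nd R → List (Fin nd)
  f (leg _ _) = []
  f (oper o)  = dests o

IsDroneTour : ∀ {nd R} → R → R → List (Piece nd R) → Set
IsDroneTour {nd} w0 wt T =
  Linked DiffKind T × Path w0 T wt × All PieceOK T ×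
  Unique (visitOrder T) × (∀ (v : Fin nd) → v ∈ visitOrder T)

Precedes : ∀ {nd} → List (Fin nd) → Fin nd → Fin nd → Set
Precedes L i j = ∃[ a ] ∃[ b ] ∃[ c ] (L ≡ a ++ (i ∷ b ++ (j ∷ c)))

InNBS : ∀ {nd} → ℕ → List (Fin nd) → Set
InNBS {nd} p L = ∀ (i j : Fin nd) → toℕ i + p ≤ toℕ j → Precedes L i j

InNBSR : ∀ {nd R} → R → R → ℕ → List (Piece nd R) → Set
InNBSR w0 wt p T = IsDroneTour w0 wt T × InNBS p (visitOrder T)

NBSRValid : ∀ {nd R} → R → R → ℕ → Operation nd R → Set
NBSRValid {nd} {R} w0 wt p o =
  ∃[ T ] (InNBSR w0 wt p T × oper o ∈ T)

IsMinIdx : ∀ {nd R} → Operation nd R → Fin nd → Set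
IsMinIdx o m = m ∈S o × (∀ j → j ∈S o → toℕ m ≤ toℕ j)

IsMaxIdx : ∀ {nd R} → Operation nd R → Fin nd → Set
IsMaxIdx o M = M ∈S o × (∀ j → j ∈S o → toℕ j ≤ toℕ M)

{-# OPTIONS --safe #-}
module Submission where

-- The destinations of o form a contiguous block of the visiting order of the
-- tour. If i + p ≤ M then the neighbourhood forces v_i to be visited before
-- v_M, so v_i is not after the block; symmetrically m + p ≤ i puts v_i after
-- v_m, so not before it. Since every destination is visited exactly once,
-- v_i lies in the block.

open import Defs
open import Data.Nat using (ℕ; _+_; _≤_)
open import Data.Fin using (Fin; toℕ)
open import Data.List using (List; []; _∷_; _++_)
open import Data.List.Properties using (++-assoc; ∷-injective)
open import Data.List.Relation.Unary.Any using (here; there)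
open import Data.List.Relation.Unary.All as All using ()
open import Data.List.Relation.Unary.AllPairs using (_∷_)
open import Data.List.Membership.Propositional using (_∈_; _∉_)
open import Data.List.Membership.Propositional.Properties using (∈-++⁺ˡ; ∈-++⁺ʳ; ∈-++⁻)
open import Data.List.Relation.Unary.Unique.Propositional using (Unique)
open import Data.Product using (∃-syntax; _,_)
open import Data.Sum using (inj₁; inj₂)
open import Relation.Nullary using (¬_; contradiction)
open import Relation.Binary.PropositionalEquality using (_≡_; refl; sym; trans; cong; subst)

-- The occurrences of u and v exhibited by the precedence are the unique
-- ones, so they must be the occurrences in P and in Q respectively.
unique-++⇒¬Precedes : ∀ {nd} (P Q : List (Fin nd)) {u v : Fin nd} →
                      Unique (P ++ Q) → u ∈ P → v ∈ Q → ¬ Precedes (P ++ Q) v u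
unique-++⇒¬Precedes (x ∷ P) Q (x∉ ∷ _) _ v∈Q ([] , b , c , eq)
  with refl , _ ← ∷-injective eq = All.lookup x∉ (∈-++⁺ʳ P v∈Q) refl
unique-++⇒¬Precedes (x ∷ P) Q {u} (x∉ ∷ _) (here refl) _ (_ ∷ a , b , c , eq)
  with _ , eq' ← ∷-injective eq =
  All.lookup x∉ (subst (u ∈_) (sym eq') (∈-++⁺ʳ a (there (∈-++⁺ʳ b (here refl))))) refl
unique-++⇒¬Precedes (x ∷ P) Q (_ ∷ uq) (there u∈P) v∈Q (_ ∷ a , b , c , eq)
  with _ , eq' ← ∷-injective eq = unique-++⇒¬Precedes P Q uq u∈P v∈Q (a , b , c , eq')

visitOrder-split : ∀ {nd R} (o : Operation nd R) (T : List (Piece nd R)) → oper o ∈ T →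
                   ∃[ A ] ∃[ B ] (visitOrder T ≡ A ++ dests o ++ B)
visitOrder-split o (_ ∷ T) (here refl) = [] , visitOrder T , refl
visitOrder-split o (leg _ _ ∷ T) (there o∈T) = visitOrder-split o T o∈T
visitOrder-split o (oper o' ∷ T) (there o∈T) with A , B , eq ← visitOrder-split o T o∈T =
  dests o' ++ A , B , trans (cong (dests o' ++_) eq) (sym (++-assoc (dests o') A _))

module _ {nd : ℕ} (A D B : List (Fin nd)) (uq : Unique (A ++ D ++ B)) where

  preceded-from-inside⇒∉-before : ∀ {m i} → m ∈ D → Precedes (A ++ D ++ B) m i → i ∉ A
  preceded-from-inside⇒∉-before m∈D m≺i i∈A =
    unique-++⇒¬Precedes A (D ++ B) uq i∈A (∈-++⁺ˡ m∈D) m≺i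

  precedes-inside⇒∉-after : ∀ {i M} → M ∈ D → Precedes (A ++ D ++ B) i M → i ∉ B
  precedes-inside⇒∉-after {i} {M} M∈D i≺M i∈B =
    unique-++⇒¬Precedes (A ++ D) B (subst Unique reassoc uq) (∈-++⁺ʳ A M∈D) i∈B
      (subst (λ L → Precedes L i M) reassoc i≺M)
    where
    reassoc : A ++ D ++ B ≡ (A ++ D) ++ B
    reassoc = sym (++-assoc A D B)

InNBS⇒∈-block : ∀ {nd p} {L A D B : List (Fin nd)} → L ≡ A ++ D ++ B →
                Unique L → InNBS p L → ∀ {m M i} → m ∈ D → M ∈ D → i ∈ L →
                toℕ m + p ≤ toℕ i → toℕ i + p ≤ toℕ M → i ∈ D
InNBS⇒∈-block {A = A} {D} {B} refl uq nbs {m} {M} {i} m∈D M∈D i∈L m+p≤i i+p≤M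
  with ∈-++⁻ A i∈L
... | inj₁ i∈A = contradiction i∈A (preceded-from-inside⇒∉-before A D B uq m∈D (nbs m i m+p≤i))
... | inj₂ i∈D++B with ∈-++⁻ D i∈D++B
...   | inj₁ i∈D = i∈D
...   | inj₂ i∈B = contradiction i∈B (precedes-inside⇒∉-after A D B uq M∈D (nbs i M i+p≤M))

lemma2 : ∀ {nd : ℕ} {R : Set} (w0 wt : R) (p : ℕ) (o : Operation nd R) →
    NBSRValid w0 wt p o →
    (m M : Fin nd) → IsMinIdx o m → IsMaxIdx o M →
    ∀ (i : Fin nd) → toℕ m + p ≤ toℕ i → toℕ i + p ≤ toℕ M → i ∈S o
lemma2 w0 wt p o (T , ((_ , _ , _ , uq , covers) , nbs) , o∈T) m M (m∈S , _) (M∈S , _) i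
  with A , B , eq ← visitOrder-split o T o∈T =
  InNBS⇒∈-block {A = A} {dests o} {B} eq uq nbs m∈S M∈S (covers i)
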